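{- Let $n=p_1^{n_1}\cdots p_r^{n_r}$ with primes $p_1<\cdots<p_r$ and positive integers $n_i$. Then $\phi\!\left(\frac{n}{p_j}\right)>\frac{n}{p_jp_r}-\phi\!\left(\frac{n}{p_jp_r}\right)$ for every $j\in[r-1]$.
   Context: $\phi$ is Euler's totient function; $[m]=\{1,\dots,m\}$. -}

module Defs where

open import Data.Nat using (ℕ; zero; suc; _*_; _^_; _/_)
open import Data.Nat.Coprimality using (Coprime; coprime?)
open import Data.List using (List; length; filter; map; upTo)
open import Data.Fin using (Fin; zero; suc)

φ : ℕ → ℕ
φ n = length (filter (λ k → coprime? k n) (map suc (upTo n)))

∏ : (m : ℕ) → (Fin m → ℕ) → ℕ
∏ zero    f = 1
∏ (suc m) f = f zero * ∏ m (λ i → f (suc i))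

-- Natural-number division; only ever applied to exact divisions by
-- nonzero divisors (products of primes) in the statement.
-- The zero case is a harmless convention (never used).
_div_ : ℕ → ℕ → ℕ
m div zero    = zero
m div (suc d) = m / suc d

-- Put N = n/(p_j p_r), so that n/p_j = p_r N; since φ(N) > 0 it suffices to
-- show N ≤ φ(p_r N). Counting the integers in [p m] coprime to m gives
-- φ(p m) ≥ (p - 1) φ(m) for a prime p, and φ(p m) ≥ p φ(m) when p ∣ m. Along
-- an increasing factorisation these telescope to N ≤ L φ(N) for any bound L on
-- the primes of N. If p_r ∣ N take L = p_r and use φ(p_r N) ≥ p_r φ(N);
-- otherwise all primes of N are below p_r, so L = p_r - 1 and
-- φ(p_r N) ≥ (p_r - 1) φ(N) suffice.

module Submission where

open import Defs
open import Data.Nat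
open import Data.Nat.Properties
open import Data.Nat.Divisibility
open import Data.Nat.DivMod using (m*n/n≡m)
open import Data.Nat.Coprimality using (Coprime; coprime?; coprime-+; coprime-divisor; 1-coprimeTo)
open import Data.Nat.Primality using (Prime; prime⇒irreducible; prime⇒nonTrivial; prime⇒nonZero)
open import Data.Nat.Tactic.RingSolver using (solve-∀)
open import Algebra.Properties.CommutativeSemigroup *-commutativeSemigroup using (x∙yz≈y∙xz)
open import Data.Fin as Fin using (Fin; zero; suc; toℕ; fromℕ)
open import Data.Fin.Properties using (toℕ-fromℕ; toℕ-injective; ≤fromℕ)
open import Data.Vec.Functional using (updateAt)
open import Data.Vec.Functional.Properties using (updateAt-minimal)
open import Data.List using ([]; _∷_; _++_; length; filter; map; upTo)
open import Data.List.Properties using (upTo-∷ʳ; map-++; filter-++; length-++; filter-accept)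
open import Data.Product using (_×_; _,_)
open import Data.Sum using (_⊎_; inj₁; inj₂)
open import Data.Empty using (⊥-elim)
open import Function using (_∘_)
open import Relation.Nullary using (Dec; yes; no; ¬_)
open import Relation.Nullary.Decidable using (_×-dec_)
open import Relation.Unary using (Pred; Decidable)
open import Relation.Binary using (_Preserves_⟶_)
open import Relation.Binary.PropositionalEquality

-- f 1 + ⋯ + f L: the range [n] used in φ starts at 1.
sumTo : ℕ → (ℕ → ℕ) → ℕ
sumTo zero    f = 0
sumTo (suc L) f = sumTo L f + f (suc L)

sumTo-mono : ∀ L {f g : ℕ → ℕ} → (∀ x → f x ≤ g x) → sumTo L f ≤ sumTo L g
sumTo-mono zero    f≤g = ≤-refl
sumTo-mono (suc L) f≤g = +-mono-≤ (sumTo-mono L f≤g) (f≤g (suc L))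

sumTo-cong : ∀ L {f g : ℕ → ℕ} → (∀ x → f x ≡ g x) → sumTo L f ≡ sumTo L g
sumTo-cong L f≡g = ≤-antisym (sumTo-mono L (≤-reflexive ∘ f≡g)) (sumTo-mono L (≤-reflexive ∘ sym ∘ f≡g))

sumTo-distrib-+ : ∀ L (f g : ℕ → ℕ) → sumTo L (λ x → f x + g x) ≡ sumTo L f + sumTo L g
sumTo-distrib-+ zero    f g = refl
sumTo-distrib-+ (suc L) f g rewrite sumTo-distrib-+ L f g = interchange (sumTo L f) (sumTo L g) _ _
  where
  interchange : ∀ a b c d → a + b + (c + d) ≡ a + c + (b + d)
  interchange = solve-∀

sumTo-+ : ∀ L K (f : ℕ → ℕ) → sumTo (L + K) f ≡ sumTo L f + sumTo K (λ x → f (L + x))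
sumTo-+ L zero    f = trans (cong (λ M → sumTo M f) (+-identityʳ L)) (sym (+-identityʳ _))
sumTo-+ L (suc K) f = begin
  sumTo (L + suc K) f                                  ≡⟨ cong (λ M → sumTo M f) (+-suc L K) ⟩
  sumTo (L + K) f + f (suc (L + K))                    ≡⟨ cong₂ _+_ (sumTo-+ L K f) (cong f (sym (+-suc L K))) ⟩
  sumTo L f + sumTo K (λ x → f (L + x)) + f (L + suc K) ≡⟨ +-assoc (sumTo L f) _ _ ⟩
  sumTo L f + sumTo (suc K) (λ x → f (L + x))          ∎
  where open ≡-Reasoning

sumTo-≡0 : ∀ L {f : ℕ → ℕ} → (∀ x → x < L → f (suc x) ≡ 0) → sumTo L f ≡ 0
sumTo-≡0 zero    f≡0 = refl
sumTo-≡0 (suc L) f≡0 = cong₂ _+_ (sumTo-≡0 L (λ x x<L → f≡0 x (m<n⇒m<1+n x<L))) (f≡0 L (n<1+n L))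

sumTo-periodic : ∀ M (f : ℕ → ℕ) → (∀ x → f (M + x) ≡ f x) → ∀ k → sumTo (k * M) f ≡ k * sumTo M f
sumTo-periodic M f periodic zero    = refl
sumTo-periodic M f periodic (suc k) = begin
  sumTo (M + k * M) f                            ≡⟨ sumTo-+ M (k * M) f ⟩
  sumTo M f + sumTo (k * M) (λ x → f (M + x))    ≡⟨ cong (sumTo M f +_) (sumTo-cong (k * M) periodic) ⟩
  sumTo M f + sumTo (k * M) f                    ≡⟨ cong (sumTo M f +_) (sumTo-periodic M f periodic k) ⟩
  sumTo M f + k * sumTo M f                      ∎
  where open ≡-Reasoning

sumTo-multiples : ∀ q .{{_ : NonZero q}} (g : ℕ → ℕ) → (∀ x → ¬ q ∣ x → g x ≡ 0) →
                  ∀ M → sumTo (M * q) g ≡ sumTo M (λ y → g (y * q))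
sumTo-multiples q       g g≡0 zero    = refl
sumTo-multiples q@(suc q′) g g≡0 (suc M) = begin
  sumTo (q + M * q) g                              ≡⟨ cong (λ L → sumTo L g) (+-comm q (M * q)) ⟩
  sumTo (M * q + q) g                              ≡⟨ sumTo-+ (M * q) q g ⟩
  sumTo (M * q) g + sumTo q (λ x → g (M * q + x))  ≡⟨ cong₂ _+_ (sumTo-multiples q g g≡0 M) lastBlock ⟩
  sumTo M (λ y → g (y * q)) + g (q + M * q)        ∎
  where
  open ≡-Reasoning
  lastBlock : sumTo q (λ x → g (M * q + x)) ≡ g (q + M * q)
  lastBlock = cong₂ _+_
    (sumTo-≡0 q′ (λ x x<q′ → g≡0 _ (λ q∣ → <⇒≱ (s≤s x<q′) (∣⇒≤ (∣m+n∣m⇒∣n q∣ (n∣m*n M))))))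
    (cong g (+-comm (M * q) q))

indicator : ∀ {A : Set} → Dec A → ℕ
indicator (yes _) = 1
indicator (no _)  = 0

indicator-mono : ∀ {A B : Set} → (A → B) → (a : Dec A) (b : Dec B) → indicator a ≤ indicator b
indicator-mono _   (yes _) (yes _) = ≤-refl
indicator-mono A⇒B (yes a) (no ¬b) = ⊥-elim (¬b (A⇒B a))
indicator-mono _   (no _)  b       = z≤n

indicator-cong : ∀ {A B : Set} → (A → B) → (B → A) → (a : Dec A) (b : Dec B) → indicator a ≡ indicator b
indicator-cong A⇒B B⇒A a b = ≤-antisym (indicator-mono A⇒B a b) (indicator-mono B⇒A b a)

indicator-⊎ : ∀ {A B C : Set} → (A → B ⊎ C) → (a : Dec A) (b : Dec B) (c : Dec C) →
              indicator a ≤ indicator b + indicator c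
indicator-⊎ _     (no _)  b       c = z≤n
indicator-⊎ _     (yes _) (yes _) c = m≤m+n 1 (indicator c)
indicator-⊎ A⇒B⊎C (yes a) (no ¬b) c with A⇒B⊎C a
... | inj₁ b′ = ⊥-elim (¬b b′)
... | inj₂ c′ = indicator-mono (λ _ → c′) (yes a) c

indicator-¬ : ∀ {A : Set} → ¬ A → (a : Dec A) → indicator a ≡ 0
indicator-¬ ¬a a = n≤0⇒n≡0 (indicator-mono ¬a a (no (λ ())))

length-filter-upTo : ∀ {P : Pred ℕ _} (P? : Decidable P) L →
                     length (filter P? (map suc (upTo L))) ≡ sumTo L (indicator ∘ P?)
length-filter-upTo P? zero    = refl
length-filter-upTo P? (suc L) = begin
  length (filter P? (map suc (upTo (suc L))))
    ≡⟨ cong (length ∘ filter P? ∘ map suc) (sym (upTo-∷ʳ L)) ⟩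
  length (filter P? (map suc (upTo L ++ L ∷ [])))
    ≡⟨ cong (length ∘ filter P?) (map-++ suc (upTo L) (L ∷ [])) ⟩
  length (filter P? (map suc (upTo L) ++ suc L ∷ []))
    ≡⟨ cong length (filter-++ P? (map suc (upTo L)) (suc L ∷ [])) ⟩
  length (filter P? (map suc (upTo L)) ++ filter P? (suc L ∷ []))
    ≡⟨ length-++ (filter P? (map suc (upTo L))) ⟩
  length (filter P? (map suc (upTo L))) + length (filter P? (suc L ∷ []))
    ≡⟨ cong₂ _+_ (length-filter-upTo P? L) (length-filter-[_] (suc L)) ⟩
  sumTo (suc L) (indicator ∘ P?) ∎
  where
  open ≡-Reasoning
  length-filter-[_] : ∀ x → length (filter P? (x ∷ [])) ≡ indicator (P? x)
  length-filter-[ x ] with P? x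
  ... | yes _ = refl
  ... | no _  = refl

coprimeTo : ℕ → ℕ → ℕ
coprimeTo m x = indicator (coprime? x m)

φ≡sumTo-coprimeTo : ∀ m → φ m ≡ sumTo m (coprimeTo m)
φ≡sumTo-coprimeTo m = length-filter-upTo (λ k → coprime? k m) m

φ-pos : ∀ m .{{_ : NonZero m}} → 0 < φ m
φ-pos (suc m) =
  subst (0 <_) (sym (cong length (filter-accept (λ k → coprime? k (suc m)) (1-coprimeTo (suc m))))) z<s

prime∤⇒coprime : ∀ {p x} → Prime p → ¬ p ∣ x → Coprime x p
prime∤⇒coprime pp p∤x (d∣x , d∣p) with prime⇒irreducible pp d∣p
... | inj₁ d≡1 = d≡1
... | inj₂ refl = ⊥-elim (p∤x d∣x)

prime∤∧coprime⇒coprime-* : ∀ {p x m} → Prime p → ¬ p ∣ x → Coprime x m → Coprime x (p * m)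
prime∤∧coprime⇒coprime-* {x = x} pp p∤x x⊥m {d} (d∣x , d∣pm) =
  x⊥m (d∣x , coprime-divisor (λ (e∣d , e∣p) → prime∤⇒coprime pp p∤x (∣-trans e∣d d∣x , e∣p)) d∣pm)

coprime-+⁻¹ : ∀ {m x} → Coprime (m + x) m → Coprime x m
coprime-+⁻¹ m+x⊥m (d∣x , d∣m) = m+x⊥m (∣m∣n⇒∣m+n d∣m d∣x , d∣m)

coprime-*⁻¹ : ∀ {y q m} → Coprime (y * q) m → Coprime y m
coprime-*⁻¹ {q = q} yq⊥m (d∣y , d∣m) = yq⊥m (∣m⇒∣m*n q d∣y , d∣m)

-- Only these x can be coprime to m without being coprime to p * m.
coprimeMultiple : ℕ → ℕ → ℕ → ℕ
coprimeMultiple p m x = indicator (coprime? x m ×-dec p ∣? x)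

p*φ[m]≤φ[p*m]+sumTo-coprimeMultiple : ∀ {p} m → Prime p →
  p * φ m ≤ φ (p * m) + sumTo (p * m) (coprimeMultiple p m)
p*φ[m]≤φ[p*m]+sumTo-coprimeMultiple {p} m pp = begin
  p * φ m                                      ≡⟨ cong (p *_) (φ≡sumTo-coprimeTo m) ⟩
  p * sumTo m (coprimeTo m)                     ≡⟨ sumTo-periodic m (coprimeTo m) periodic p ⟨
  sumTo (p * m) (coprimeTo m)                   ≤⟨ sumTo-mono (p * m) split ⟩
  sumTo (p * m) (λ x → coprimeTo (p * m) x + coprimeMultiple p m x)
                                               ≡⟨ sumTo-distrib-+ (p * m) (coprimeTo (p * m)) (coprimeMultiple p m) ⟩
  sumTo (p * m) (coprimeTo (p * m)) + sumTo (p * m) (coprimeMultiple p m)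
                                               ≡⟨ cong (_+ sumTo (p * m) (coprimeMultiple p m)) (φ≡sumTo-coprimeTo (p * m)) ⟨
  φ (p * m) + sumTo (p * m) (coprimeMultiple p m) ∎
  where
  open ≤-Reasoning
  periodic : ∀ x → coprimeTo m (m + x) ≡ coprimeTo m x
  periodic x = indicator-cong coprime-+⁻¹ coprime-+ (coprime? (m + x) m) (coprime? x m)
  split : ∀ x → coprimeTo m x ≤ coprimeTo (p * m) x + coprimeMultiple p m x
  split x = indicator-⊎ lose (coprime? x m) (coprime? x (p * m)) (coprime? x m ×-dec p ∣? x)
    where
    lose : Coprime x m → Coprime x (p * m) ⊎ (Coprime x m × p ∣ x)
    lose x⊥m with p ∣? x
    ... | yes p∣x = inj₂ (x⊥m , p∣x)
    ... | no p∤x  = inj₁ (prime∤∧coprime⇒coprime-* pp p∤x x⊥m)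

pred[p]*φ[m]≤φ[p*m] : ∀ {p} m → Prime p → pred p * φ m ≤ φ (p * m)
pred[p]*φ[m]≤φ[p*m] {p} m pp = +-cancelˡ-≤ (φ m) _ _ (begin
  φ m + pred p * φ m                               ≡⟨ cong (_* φ m) (suc-pred p) ⟩
  p * φ m                                          ≤⟨ p*φ[m]≤φ[p*m]+sumTo-coprimeMultiple m pp ⟩
  φ (p * m) + sumTo (p * m) (coprimeMultiple p m)  ≤⟨ +-monoʳ-≤ (φ (p * m)) multiples≤φ ⟩
  φ (p * m) + φ m                                  ≡⟨ +-comm (φ (p * m)) (φ m) ⟩
  φ m + φ (p * m)                                  ∎)
  where
  open ≤-Reasoning
  instance _ = prime⇒nonZero pp
  multiples≤φ : sumTo (p * m) (coprimeMultiple p m) ≤ φ m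
  multiples≤φ = begin
    sumTo (p * m) (coprimeMultiple p m)           ≡⟨ cong (λ L → sumTo L (coprimeMultiple p m)) (*-comm p m) ⟩
    sumTo (m * p) (coprimeMultiple p m)           ≡⟨ sumTo-multiples p (coprimeMultiple p m)
                                                      (λ x p∤x → indicator-¬ (λ (_ , p∣x) → p∤x p∣x) _) m ⟩
    sumTo m (λ y → coprimeMultiple p m (y * p))   ≤⟨ sumTo-mono m (λ y → indicator-mono
                                                      (λ (yp⊥m , _) → coprime-*⁻¹ yp⊥m) _ (coprime? y m)) ⟩
    sumTo m (coprimeTo m)                         ≡⟨ φ≡sumTo-coprimeTo m ⟨
    φ m                                           ∎

p∣m⇒p*φ[m]≤φ[p*m] : ∀ {p m} → Prime p → p ∣ m → p * φ m ≤ φ (p * m)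
p∣m⇒p*φ[m]≤φ[p*m] {p} {m} pp p∣m = begin
  p * φ m                                          ≤⟨ p*φ[m]≤φ[p*m]+sumTo-coprimeMultiple m pp ⟩
  φ (p * m) + sumTo (p * m) (coprimeMultiple p m)  ≡⟨ cong (φ (p * m) +_) (sumTo-≡0 (p * m) none) ⟩
  φ (p * m) + 0                                    ≡⟨ +-identityʳ _ ⟩
  φ (p * m)                                        ∎
  where
  open ≤-Reasoning
  p≢1 : p ≢ 1
  p≢1 = nonTrivial⇒≢1 {{prime⇒nonTrivial pp}}
  none : ∀ x → x < p * m → coprimeMultiple p m (suc x) ≡ 0
  none x _ = indicator-¬ (λ (x⊥m , p∣x) → p≢1 (x⊥m (p∣x , p∣m))) _

p∣m⇒p^k*φ[m]≤φ[p^k*m] : ∀ {p m} k → Prime p → p ∣ m → p ^ k * φ m ≤ φ (p ^ k * m)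
p∣m⇒p^k*φ[m]≤φ[p^k*m] {p} {m} zero    pp p∣m = ≤-reflexive (trans (+-identityʳ (φ m)) (cong φ (sym (+-identityʳ m))))
p∣m⇒p^k*φ[m]≤φ[p^k*m] {p} {m} (suc k) pp p∣m = begin
  p * p ^ k * φ m         ≡⟨ *-assoc p (p ^ k) (φ m) ⟩
  p * (p ^ k * φ m)       ≤⟨ *-monoʳ-≤ p (p∣m⇒p^k*φ[m]≤φ[p^k*m] k pp p∣m) ⟩
  p * φ (p ^ k * m)       ≤⟨ p∣m⇒p*φ[m]≤φ[p*m] pp (∣n⇒∣m*n (p ^ k) p∣m) ⟩
  φ (p * (p ^ k * m))     ≡⟨ cong φ (*-assoc p (p ^ k) m) ⟨
  φ (p * p ^ k * m)       ∎
  where open ≤-Reasoning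

t<p⇒p^k*t*φ[m]≤φ[p^[1+k]*m] : ∀ {p t} k m → Prime p → t < p → p ^ k * (t * φ m) ≤ φ (p ^ suc k * m)
t<p⇒p^k*t*φ[m]≤φ[p^[1+k]*m] {p} {t} k m pp t<p = begin
  p ^ k * (t * φ m)        ≤⟨ *-monoʳ-≤ (p ^ k) (*-monoˡ-≤ (φ m) (suc[m]≤n⇒m≤pred[n] t<p)) ⟩
  p ^ k * (pred p * φ m)   ≤⟨ *-monoʳ-≤ (p ^ k) (pred[p]*φ[m]≤φ[p*m] m pp) ⟩
  p ^ k * φ (p * m)        ≤⟨ p∣m⇒p^k*φ[m]≤φ[p^k*m] k pp (m∣m*n m) ⟩
  φ (p ^ k * (p * m))      ≡⟨ cong φ (reassoc (p ^ k) p m) ⟩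
  φ (p ^ suc k * m)        ∎
  where
  open ≤-Reasoning
  reassoc : ∀ a b c → a * (b * c) ≡ b * a * c
  reassoc = solve-∀

-- Telescoping: m / φ(m) = ∏ p/(p-1) over the primes of m, and with
-- t < p₁ < p₂ < ⋯ ≤ L each factor p_i/(p_i - 1) is at most p_i/p_{i-1}.
t*∏≤L*φ[∏] : ∀ m (p f : Fin m → ℕ) → (∀ i → Prime (p i)) → p Preserves Fin._<_ ⟶ _<_ →
             ∀ {t L} → t ≤ L → (∀ i → t < p i) → (∀ i → 0 < f i → p i ≤ L) →
             t * ∏ m (λ i → p i ^ f i) ≤ L * φ (∏ m (λ i → p i ^ f i))
t*∏≤L*φ[∏] zero    p f prime incr t≤L t<p p≤L = *-monoˡ-≤ 1 t≤L
t*∏≤L*φ[∏] (suc m) p f prime incr {t} {L} t≤L t<p p≤L = head (f zero) refl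
  where
  open ≤-Reasoning
  P = p zero
  rest = ∏ m (λ i → p (suc i) ^ f (suc i))
  tail : ∀ {s} → s ≤ L → (∀ i → s < p (suc i)) → s * rest ≤ L * φ rest
  tail s≤L s<p = t*∏≤L*φ[∏] m (p ∘ suc) (f ∘ suc) (prime ∘ suc) (incr ∘ s<s) s≤L s<p (p≤L ∘ suc)
  head : ∀ e → f zero ≡ e → t * (P ^ e * rest) ≤ L * φ (P ^ e * rest)
  head zero    _ rewrite *-identityˡ rest = tail t≤L (t<p ∘ suc)
  head (suc k) f₀≡ = begin
    t * (P ^ suc k * rest)         ≡⟨ reassoc t P (P ^ k) rest ⟩
    P ^ k * (t * (P * rest))       ≤⟨ *-monoʳ-≤ (P ^ k) (*-monoʳ-≤ t (tail P≤L (λ i → incr z<s))) ⟩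
    P ^ k * (t * (L * φ rest))     ≡⟨ reassoc′ (P ^ k) t L (φ rest) ⟩
    L * (P ^ k * (t * φ rest))     ≤⟨ *-monoʳ-≤ L (t<p⇒p^k*t*φ[m]≤φ[p^[1+k]*m] k rest (prime zero) (t<p zero)) ⟩
    L * φ (P ^ suc k * rest)       ∎
    where
    P≤L : P ≤ L
    P≤L = p≤L zero (subst (0 <_) (sym f₀≡) z<s)
    reassoc : ∀ a b c d → a * (b * c * d) ≡ c * (a * (b * d))
    reassoc = solve-∀
    reassoc′ : ∀ a b c d → a * (b * (c * d)) ≡ c * (a * (b * d))
    reassoc′ = solve-∀

∏-nonZero : ∀ m (p f : Fin m → ℕ) → (∀ i → NonZero (p i)) → NonZero (∏ m (λ i → p i ^ f i))
∏-nonZero zero    p f p≢0 = _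
∏-nonZero (suc m) p f p≢0 =
  m*n≢0 _ _ {{m^n≢0 (p zero) (f zero) {{p≢0 zero}}}} {{∏-nonZero m (p ∘ suc) (f ∘ suc) (p≢0 ∘ suc)}}

p∣∏ : ∀ m (p f : Fin m → ℕ) k → 0 < f k → p k ∣ ∏ m (λ i → p i ^ f i)
p∣∏ (suc m) p f zero f₀>0 with f zero
... | suc e = ∣m⇒∣m*n _ (m∣m*n (p zero ^ e))
p∣∏ (suc m) p f (suc k) fₖ>0 = ∣n⇒∣m*n (p zero ^ f zero) (p∣∏ m (p ∘ suc) (f ∘ suc) k fₖ>0)

∏-extract : ∀ m (p e : Fin m → ℕ) k → 0 < e k →
            ∏ m (λ i → p i ^ e i) ≡ p k * ∏ m (λ i → p i ^ updateAt e k pred i)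
∏-extract (suc m) p e zero    e₀>0 with e zero
... | suc a = *-assoc (p zero) (p zero ^ a) _
∏-extract (suc m) p e (suc k) eₖ>0 = begin
  p zero ^ e zero * ∏ m (λ i → p (suc i) ^ e (suc i))
    ≡⟨ cong (p zero ^ e zero *_) (∏-extract m (p ∘ suc) (e ∘ suc) k eₖ>0) ⟩
  p zero ^ e zero * (p (suc k) * ∏ m (λ i → p (suc i) ^ updateAt (e ∘ suc) k pred i))
    ≡⟨ x∙yz≈y∙xz (p zero ^ e zero) (p (suc k)) _ ⟩
  p (suc k) * (p zero ^ e zero * ∏ m (λ i → p (suc i) ^ updateAt (e ∘ suc) k pred i)) ∎
  where open ≡-Reasoning

m≡n*o⇒m-div-n≡o : ∀ {m} n o .{{_ : NonZero n}} → m ≡ n * o → m div n ≡ o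
m≡n*o⇒m-div-n≡o (suc n) o refl = trans (cong (_/ suc n) (*-comm (suc n) o)) (m*n/n≡m o (suc n))

∏-extract₂ : ∀ m (p e : Fin m → ℕ) j k → j ≢ k → 0 < e j → 0 < e k →
             ∏ m (λ i → p i ^ e i) ≡ p j * (p k * ∏ m (λ i → p i ^ updateAt (updateAt e j pred) k pred i))
∏-extract₂ m p e j k j≢k eⱼ>0 eₖ>0 = trans (∏-extract m p e j eⱼ>0)
  (cong (p j *_) (∏-extract m p (updateAt e j pred) k
    (subst (0 <_) (sym (updateAt-minimal k j e (j≢k ∘ sym))) eₖ>0)))

∏≤φ[max*∏] : ∀ r (p f : Fin (suc r) → ℕ) → (∀ i → Prime (p i)) → p Preserves Fin._<_ ⟶ _<_ →
             ∏ (suc r) (λ i → p i ^ f i) ≤ φ (p (fromℕ r) * ∏ (suc r) (λ i → p i ^ f i))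
∏≤φ[max*∏] r p f prime incr = byExponentOfMax (f (fromℕ r)) refl
  where
  q = p (fromℕ r)
  M = ∏ (suc r) (λ i → p i ^ f i)
  1<p : ∀ i → 1 < p i
  1<p i = nonTrivial⇒n>1 (p i) {{prime⇒nonTrivial (prime i)}}
  below-max : ∀ i → i ≢ fromℕ r → p i < q
  below-max i i≢max = incr (≤∧≢⇒< (≤fromℕ i) (i≢max ∘ toℕ-injective))
  ≤-max : ∀ i → p i ≤ q
  ≤-max i with i Fin.≟ fromℕ r
  ... | yes refl   = ≤-refl
  ... | no i≢max   = <⇒≤ (below-max i i≢max)
  M≤L*φM : ∀ {L} → 1 ≤ L → (∀ i → 0 < f i → p i ≤ L) → M ≤ L * φ M
  M≤L*φM {L} 1≤L p≤L = subst (_≤ L * φ M) (*-identityˡ M) (t*∏≤L*φ[∏] (suc r) p f prime incr 1≤L 1<p p≤L)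
  byExponentOfMax : ∀ e → f (fromℕ r) ≡ e → M ≤ φ (q * M)
  byExponentOfMax (suc _) fmax≡ = ≤-trans
    (M≤L*φM (<⇒≤ (1<p (fromℕ r))) (λ i _ → ≤-max i))
    (p∣m⇒p*φ[m]≤φ[p*m] (prime (fromℕ r)) (p∣∏ (suc r) p f (fromℕ r) (subst (0 <_) (sym fmax≡) z<s)))
  byExponentOfMax zero    fmax≡ = ≤-trans
    (M≤L*φM (suc[m]≤n⇒m≤pred[n] (1<p (fromℕ r))) (λ i fᵢ>0 → suc[m]≤n⇒m≤pred[n] (below-max i (not-max fᵢ>0))))
    (pred[p]*φ[m]≤φ[p*m] M (prime (fromℕ r)))
    where
    not-max : ∀ {i} → 0 < f i → i ≢ fromℕ r
    not-max fᵢ>0 refl = <-irrefl (sym fmax≡) fᵢ>0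

lemma2p7 : (n r : ℕ) (p : Fin (suc r) → ℕ) (e : Fin (suc r) → ℕ) →
    (∀ i → Prime (p i)) →
    (∀ i k → toℕ i < toℕ k → p i < p k) →
    (∀ i → 0 < e i) →
    n ≡ ∏ (suc r) (λ i → p i ^ e i) →
    (j : Fin (suc r)) → toℕ j < r →
    n div (p j * p (fromℕ r)) ∸ φ (n div (p j * p (fromℕ r))) < φ (n div p j)
lemma2p7 n r p e prime incr e>0 n≡∏ j j<r = begin-strict
  n div (p j * q) ∸ φ (n div (p j * q))  ≡⟨ cong (λ x → x ∸ φ x) n/[pⱼq]≡N ⟩
  N ∸ φ N                               <⟨ m<n+o⇒m∸n<o N (φ N) (m<n+m N (φ-pos N)) ⟩
  N                                     ≤⟨ ∏≤φ[max*∏] r p f prime (incr _ _) ⟩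
  φ (q * N)                             ≡⟨ cong φ n/pⱼ≡qN ⟨
  φ (n div p j)                         ∎
  where
  open ≤-Reasoning
  q = p (fromℕ r)
  f = updateAt (updateAt e j pred) (fromℕ r) pred
  N = ∏ (suc r) (λ i → p i ^ f i)
  instance
    _ = ∏-nonZero (suc r) p f (prime⇒nonZero ∘ prime)
    pⱼ≢0 = prime⇒nonZero (prime j)
    _ = m*n≢0 (p j) q {{pⱼ≢0}} {{prime⇒nonZero (prime (fromℕ r))}}
  j≢max : j ≢ fromℕ r
  j≢max j≡max = <-irrefl (trans (cong toℕ j≡max) (toℕ-fromℕ r)) j<r
  n≡pⱼqN : n ≡ p j * (q * N)
  n≡pⱼqN = trans n≡∏ (∏-extract₂ (suc r) p e j (fromℕ r) j≢max (e>0 j) (e>0 (fromℕ r)))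
  n/[pⱼq]≡N : n div (p j * q) ≡ N
  n/[pⱼq]≡N = m≡n*o⇒m-div-n≡o (p j * q) N (trans n≡pⱼqN (sym (*-assoc (p j) q N)))
  n/pⱼ≡qN : n div p j ≡ q * N
  n/pⱼ≡qN = m≡n*o⇒m-div-n≡o (p j) (q * N) n≡pⱼqN
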